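{- Suppose that $n$ and $m$ are not both odd. Then the set of critical numbers is nonempty if and only if $l_i\ne l'_j$ for all $i\in\{1,\dots,n\}$, $j\in\{1,\dots,m\}$, i.e. $L_0\ne0$. In this situation the two numbers $t_0:=L+\frac{w+w'}{2}$ and $\theta(t_0)=w+w'+1-t_0$ are critical.
   Context: For $N\ge1$ let $L_0^+(N)$ be the set of $(w,l)\in\mathbb{Z}\times\mathbb{Z}^N$ with $l_1>\dots>l_N$, $l_i+l_{N+1-i}=0$ and $w+l_i\equiv N+1\bmod2$. Fix $n,m\ge1$, $(w,l)\in L_0^+(n)$, $(w',l')\in L_0^+(m)$, $\delta,\delta'\in\{0,1\}$. In Knapp's notation for $W_{\mathbb{R}}$, $(l,t)$ ($l\ge1$) is irreducible $2$-dimensional and $(\mathrm{sgn}^\epsilon,t)$ is $1$-dimensional, $L(s,(l,t))=\Gamma_{\mathbb{C}}(s+t+\frac l2)$, $L(s,(\mathrm{sgn}^\epsilon,t))=\Gamma_{\mathbb{R}}(s+t+\epsilon)$, $\Gamma_{\mathbb{R}}(s)=\pi^{ -s/2}\Gamma(s/2)$, $\Gamma_{\mathbb{C}}(s)=2(2\pi)^{ -s}\Gamma(s)$; $L$-functions multiplicative over irreducible constituents, tensor products decomposing via $(l,t)\otimes(l',t')=(l+l',t+t')\oplus(|l-l'|,t+t')$ with $(0,t):=(\mathrm{sgn}^0,t)\oplus(\mathrm{sgn}^1,t)$, $(l,t)\otimes(\mathrm{sgn}^\epsilon,t')=(l,t+t')$. $\pi_\infty^W=\bigoplus_{i\le n/2}(l_i,-w/2)$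 plus $(\mathrm{sgn}^\delta,-w/2)$ if $n$ odd; $\sigma_\infty^W$ analogously; $\tau=\pi_\infty^W\otimes\sigma_\infty^W$, $\check\tau$ its contragredient. $t\in\frac{n+m}{2}+\mathbb{Z}$ is critical if neither $L(s,\tau)$ nor $L(1-s,\check\tau)$ has a pole at $s=t$. $L_0=\min_{i,j}|l_i-l'_j|$, $L=L_0/2$. -}

module Defs where

open import Data.Bool using (Bool; true; false; if_then_else_; _xor_)
open import Data.Nat as ℕ using (ℕ; zero; suc; _⊓_; _%_) renaming (∣_-_∣ to distℕ)
open import Data.Integer as ℤ using (ℤ; +_; _+_; _-_; -_; _≤_; ∣_∣)
open import Data.Integer.Divisibility using (_∣_)
open import Data.Fin using (Fin; toℕ; opposite)
open import Data.List using (List; []; _∷_; _++_; map; filter; concatMap; foldr; allFin)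
open import Data.Product using (_×_; Σ; ∃)
open import Relation.Nullary using (¬_; does)
open import Relation.Binary.PropositionalEquality using (_≡_)

-- Conventions: every real parameter t, s that occurs is a half-integer;
-- we always store the DOUBLED value 2t (resp. 2s) as an integer.

record L0plus (N : ℕ) (w : ℤ) (l : Fin N → ℤ) : Set where
  field
    decr   : ∀ i j → toℕ i ℕ.< toℕ j → l j ℤ.< l i
    antisym : ∀ i → l i + l (opposite i) ≡ + 0
    parity : ∀ i → (+ 2) ∣ (w + l i - + (suc N))

-- Irreducible representations of W_R (Knapp's notation), with doubled t:
--   two l T  = (l , T/2)       (2-dimensional; used only with l ≥ 1)
--   one ε T  = (sgn^ε , T/2)   (1-dimensional; ε = true means sgn^1)
data WIrr : Set where
  two : ℕ → ℤ → WIrr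
  one : Bool → ℤ → WIrr

-- finite-dimensional (semisimple) representations: lists of irreducibles
WRep : Set
WRep = List WIrr

εℤ : Bool → ℤ
εℤ true  = + 1
εℤ false = + 0

-- (l , t) with l = 0 is by convention (sgn^0, t) ⊕ (sgn^1, t)
twoOrSplit : ℕ → ℤ → WRep
twoOrSplit zero    T = one false T ∷ one true T ∷ []
twoOrSplit (suc k) T = two (suc k) T ∷ []

_⊗ᵢ_ : WIrr → WIrr → WRep
two l T ⊗ᵢ two l' T' = two (l ℕ.+ l') (T + T') ∷ twoOrSplit (distℕ l l') (T + T')
two l T ⊗ᵢ one ε' T' = two l (T + T') ∷ []
one ε T ⊗ᵢ two l' T' = two l' (T + T') ∷ []
one ε T ⊗ᵢ one ε' T' = one (ε xor ε') (T + T') ∷ []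

_⊗_ : WRep → WRep → WRep
ρ ⊗ σ = concatMap (λ a → concatMap (λ b → a ⊗ᵢ b) σ) ρ

dualᵢ : WIrr → WIrr
dualᵢ (two l T) = two l (- T)
dualᵢ (one ε T) = one ε (- T)

dual : WRep → WRep
dual = map dualᵢ

-- Poles of the Gamma factors, in doubled coordinates Z = 2z:
--   Γ_C(z) = 2(2π)^{-z} Γ(z) has a pole iff z ∈ {0,-1,-2,...}
--   Γ_R(z) = π^{-z/2} Γ(z/2) has a pole iff z ∈ {0,-2,-4,...}
ΓCPole : ℤ → Set
ΓCPole Z = (Z ≤ + 0) × ((+ 2) ∣ Z)

ΓRPole : ℤ → Set
ΓRPole Z = (Z ≤ + 0) × ((+ 4) ∣ Z)

-- L(s,(l,t)) = Γ_C(s+t+l/2),  L(s,(sgn^ε,t)) = Γ_R(s+t+ε); S = 2s.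
PoleIrr : ℤ → WIrr → Set
PoleIrr S (two l T) = ΓCPole (S + T + + l)
PoleIrr S (one ε T) = ΓRPole (S + T + (+ 2) ℤ.* εℤ ε)

-- L(s,ρ) is the product of the factors of the constituents; since Γ has
-- no zeros, it has a pole at s iff one of the factors does.
data Pole (S : ℤ) : WRep → Set where
  here  : ∀ {a ρ} → PoleIrr S a → Pole S (a ∷ ρ)
  there : ∀ {a ρ} → Pole S ρ → Pole S (a ∷ ρ)

isOdd : ℕ → Bool
isOdd n = does (n % 2 ℕ.≟ 1)

-- π_∞^W = ⊕_{i ≤ N/2} (l_i , -w/2)  ⊕ (sgn^δ , -w/2) if N odd
-- (Fin index i corresponds to the paper's index i+1)
piW : (N : ℕ) → ℤ → (Fin N → ℤ) → Bool → WRep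
piW N w l δ =
  map (λ i → two ∣ l i ∣ (- w))
      (filter (λ i → 2 ℕ.* suc (toℕ i) ℕ.≤? N) (allFin N))
  ++ (if isOdd N then one δ (- w) ∷ [] else [])

-- t (doubled: T = 2t) is critical for τ: t ∈ (n+m)/2 + ℤ and neither
-- L(s,τ) nor L(1-s,τˇ) has a pole at s = t.
Critical : ℕ → ℕ → WRep → ℤ → Set
Critical n m τ T =
  ((+ 2) ∣ (T - + (n ℕ.+ m))) × ¬ Pole T τ × ¬ Pole (+ 2 - T) (dual τ)

minList : List ℕ → ℕ
minList []       = 0
minList (x ∷ xs) = foldr _⊓_ x xs

L0 : (n m : ℕ) → (Fin n → ℤ) → (Fin m → ℤ) → ℕ
L0 n m l l' = minList (concatMap (λ i → map (λ j → ∣ l i - l' j ∣) (allFin m)) (allFin n))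

-- Every constituent of τ has the same "weight" t = -(w+w')/2, so both L(s,τ) and L(1-s,τˇ) are
-- products of factors Γ_C(s + t + k/2) or Γ_R(s + t + ε).  If the labels are disjoint, every
-- constituent is 2-dimensional with k ≥ L_0 (the sums and differences |l_i| ± |l'_j| are all
-- distances between labels, since each label set is symmetric under negation), so at t₀ and
-- θ(t₀) every Gamma argument is positive.  If a label is shared, τ contains (0,t), i.e. the
-- pair (sgn⁰,t) ⊕ (sgn¹,t); at any t of the right parity one of these factors or of their
-- duals sits at a pole, so nothing is critical.

module Submission where

open import Defs
open import Data.Bool using (Bool; false; true; if_then_else_)
open import Data.Nat as ℕ using (ℕ; zero; suc; _%_; _⊓_; z≤n; s≤s) renaming (∣_-_∣ to distℕ)
import Data.Nat.Properties as ℕP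
open import Data.Nat.DivMod using (_/_; m≡m%n+[m/n]*n; [m+kn]%n≡m%n)
import Data.Nat.Tactic.RingSolver as ℕSolver
open import Data.Integer as ℤ using (ℤ; +_; -[1+_]; _+_; _-_; -_; ∣_∣; +≤+; -≤+; +<+)
import Data.Integer.Properties as ℤP
open import Data.Integer.DivMod using (_%ℕ_; _/ℕ_; n%ℕd<d; a≡a%ℕn+[a/ℕn]*n)
open import Data.Integer.Divisibility.Signed
  using (_∣_; divides; ∣ᵤ⇒∣; ∣⇒∣ᵤ; ∣m∣n⇒∣m+n; ∣m∣n⇒∣m-n)
open import Data.Integer.Tactic.RingSolver using (solve-∀)
open import Data.Fin using (Fin; toℕ; opposite; fromℕ<)
import Data.Fin.Properties as FinP
open import Data.List using (List; []; _∷_; map; filter; concatMap; allFin)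
open import Data.List.Relation.Unary.Any using (here; there)
import Data.List.Relation.Unary.Any as Any
open import Data.List.Membership.Propositional using (_∈_; find; lose)
open import Data.List.Membership.Propositional.Properties
  using (∈-map⁺; ∈-map⁻; ∈-++⁺ˡ; ∈-++⁺ʳ; ∈-++⁻; ∈-concatMap⁺; ∈-concatMap⁻; ∈-filter⁺; ∈-allFin;
         foldr-selective)
open import Data.List.Properties using (foldr-preservesᵒ)
open import Data.Product using (_×_; _,_; proj₁; ∃; ∃₂)
open import Data.Sum using (_⊎_; inj₁; inj₂; [_,_]′)
open import Relation.Nullary using (¬_; Dec; yes; does; contradiction)
open import Relation.Binary.Definitions using (tri<; tri≈; tri>)
open import Relation.Nullary.Decidable using (dec-true)
open import Relation.Binary.PropositionalEquality
  using (_≡_; _≢_; refl; sym; trans; cong; subst)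
open import Function.Bundles using (_⇔_; mk⇔)
open import Algebra.Bundles using (AbelianGroup)
open import Algebra.Properties.Group (AbelianGroup.group ℤP.+-0-abelianGroup)
  using (inverseʳ-unique)

minList-≤ : ∀ {xs y} → y ∈ xs → minList xs ℕ.≤ y
minList-≤ {x ∷ xs} y∈ = foldr-preservesᵒ ⊓-≤ x xs (bound y∈)
  where
  ⊓-≤ : ∀ {y} a b → a ℕ.≤ y ⊎ b ℕ.≤ y → a ⊓ b ℕ.≤ y
  ⊓-≤ a b (inj₁ a≤y) = ℕP.m≤n⇒m⊓o≤n b a≤y
  ⊓-≤ a b (inj₂ b≤y) = ℕP.m≤n⇒o⊓m≤n a b≤y
  bound : ∀ {y} → y ∈ x ∷ xs → x ℕ.≤ y ⊎ Any.Any (ℕ._≤ y) xs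
  bound (here refl) = inj₁ ℕP.≤-refl
  bound (there y∈)  = inj₂ (Any.map (λ { refl → ℕP.≤-refl }) y∈)

minList-∈ : ∀ {xs y} → y ∈ xs → minList xs ∈ xs
minList-∈ {x ∷ xs} _ with foldr-selective ℕP.⊓-sel x xs
... | inj₁ min≡x  = here min≡x
... | inj₂ min∈xs = there min∈xs

∣+a-+b∣ : ∀ a b → ∣ + a - + b ∣ ≡ distℕ a b
∣+a-+b∣ a b rewrite ℤP.[+m]-[+n]≡m⊖n a b with ℕP.≤-total a b
... | inj₁ a≤b = trans (ℤP.∣⊖∣-≤ a≤b) (sym (ℕP.m≤n⇒∣m-n∣≡n∸m a≤b))
... | inj₂ b≤a = trans (ℤP.∣m⊖n∣≡∣n⊖m∣ a b) (trans (ℤP.∣⊖∣-≤ b≤a) (sym (ℕP.m≤n⇒∣n-m∣≡n∸m b≤a)))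

∣+a--+b∣ : ∀ a b → ∣ + a - - + b ∣ ≡ a ℕ.+ b
∣+a--+b∣ a b = cong (λ x → ∣ + a + x ∣) (ℤP.neg-involutive (+ b))

i+i≡0⇒i≡0 : ∀ {i} → i + i ≡ + 0 → i ≡ + 0
i+i≡0⇒i≡0 {+ zero} _ = refl

2∣*2 : ∀ q → + 2 ∣ q ℤ.* + 2
2∣*2 q = divides q refl

2∣i+j⇒2∣∣i∣+j : ∀ i {j} → + 2 ∣ i + j → + 2 ∣ + ∣ i ∣ + j
2∣i+j⇒2∣∣i∣+j (+ k)      2∣i+j = 2∣i+j
2∣i+j⇒2∣∣i∣+j -[1+ k ] {j} 2∣i+j =
  subst (+ 2 ∣_) (reflect -[1+ k ] j) (∣m∣n⇒∣m-n 2∣i+j (2∣*2 -[1+ k ]))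
  where
  reflect : ∀ i j → i + j - i ℤ.* + 2 ≡ - i + j
  reflect = solve-∀

≤0⊎1≤ : ∀ q → q ℤ.≤ + 0 ⊎ + 1 ℤ.≤ q
≤0⊎1≤ (+ zero)  = inj₁ (+≤+ z≤n)
≤0⊎1≤ (+ suc k) = inj₂ (+≤+ (s≤s z≤n))
≤0⊎1≤ -[1+ k ]  = inj₁ -≤+

even⊎odd : ∀ q → ∃ λ r → q ≡ r ℤ.* + 2 ⊎ q ≡ r ℤ.* + 2 + + 1
even⊎odd q with q %ℕ 2 | n%ℕd<d q 2 | a≡a%ℕn+[a/ℕn]*n q 2
... | 0           | _            | q≡ = q /ℕ 2 , inj₁ (trans q≡ (ℤP.+-identityˡ _))
... | 1           | _            | q≡ = q /ℕ 2 , inj₂ (trans q≡ (ℤP.+-comm (+ 1) (q /ℕ 2 ℤ.* + 2)))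
... | suc (suc _) | s≤s (s≤s ()) | _

shared-label⇒even : ∀ {T w w' x N M} → + 2 ∣ T - (N + M) →
  + 2 ∣ w + x - (+ 1 + N) → + 2 ∣ w' + x - (+ 1 + M) → + 2 ∣ T + (- w + - w')
shared-label⇒even {T} {w} {w'} {x} {N} {M} 2∣T 2∣w 2∣w' =
  subst (+ 2 ∣_) (identity T w w' x N M)
    (∣m∣n⇒∣m+n (∣m∣n⇒∣m-n (∣m∣n⇒∣m-n 2∣T 2∣w) 2∣w') (2∣*2 (x - + 1)))
  where
  identity : ∀ T w w' x N M →
    T - (N + M) - (w + x - (+ 1 + N)) - (w' + x - (+ 1 + M)) + (x - + 1) ℤ.* + 2 ≡ T + (- w + - w')
  identity = solve-∀

labels⇒even : ∀ {w w' x y N M} → + 2 ∣ w + x - (+ 1 + N) → + 2 ∣ w' + y - (+ 1 + M) →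
  + 2 ∣ + ∣ x - y ∣ + (w + w') - (N + M)
labels⇒even {w} {w'} {x} {y} {N} {M} 2∣w 2∣w' =
  subst (+ 2 ∣_) (sym (ℤP.+-assoc (+ ∣ x - y ∣) (w + w') (- (N + M))))
    (2∣i+j⇒2∣∣i∣+j (x - y) (subst (+ 2 ∣_) (identity w w' x y N M)
                               (∣m∣n⇒∣m-n (∣m∣n⇒∣m+n 2∣w 2∣w') (2∣*2 (y - + 1)))))
  where
  identity : ∀ w w' x y N M →
    w + x - (+ 1 + N) + (w' + y - (+ 1 + M)) - (y - + 1) ℤ.* + 2 ≡ x - y + (w + w' - (N + M))
  identity = solve-∀

even⇒even-reflected : ∀ {T W N} → + 2 ∣ T - N → + 2 ∣ + 2 ℤ.* (W + + 1) - T - N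
even⇒even-reflected {T} {W} {N} 2∣T =
  subst (+ 2 ∣_) (identity T W N) (∣m∣n⇒∣m-n (2∣*2 (W + + 1 - N)) 2∣T)
  where
  identity : ∀ T W N → (W + + 1 - N) ℤ.* + 2 - (T - N) ≡ + 2 ℤ.* (W + + 1) - T - N
  identity = solve-∀

ΓCPole-*2 : ∀ {Z} q → q ℤ.≤ + 0 → Z ≡ q ℤ.* + 2 → ΓCPole Z
ΓCPole-*2 q q≤0 refl = ℤP.*-monoʳ-≤-nonNeg (+ 2) q≤0 , ∣⇒∣ᵤ (divides q refl)

ΓRPole-*4 : ∀ {Z} r → r ℤ.≤ + 0 → Z ≡ r ℤ.* + 4 → ΓRPole Z
ΓRPole-*4 r r≤0 refl = ℤP.*-monoʳ-≤-nonNeg (+ 4) r≤0 , ∣⇒∣ᵤ (divides r refl)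

even⇒ΓCPole⊎ΓCPole-reflected : ∀ {Z} → + 2 ∣ Z → ΓCPole Z ⊎ ΓCPole (+ 2 - Z)
even⇒ΓCPole⊎ΓCPole-reflected (divides q refl) with ≤0⊎1≤ q
... | inj₁ q≤0 = inj₁ (ΓCPole-*2 q q≤0 refl)
... | inj₂ 1≤q = inj₂ (ΓCPole-*2 (+ 1 - q) (ℤP.i≤j⇒i-j≤0 1≤q) (reflect q))
  where
  reflect : ∀ q → + 2 - q ℤ.* + 2 ≡ (+ 1 - q) ℤ.* + 2
  reflect = solve-∀

-- Z = 4r: pole at Z or at 4 - Z; Z = 4r + 2: pole at Z + 2 or at 2 - Z.
even⇒ΓRPole : ∀ {Z} → + 2 ∣ Z →
  (ΓRPole Z ⊎ ΓRPole (Z + + 2)) ⊎ (ΓRPole (+ 2 - Z) ⊎ ΓRPole (+ 2 - Z + + 2))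
even⇒ΓRPole (divides q refl) with even⊎odd q
... | r , inj₁ refl with ≤0⊎1≤ r
...   | inj₁ r≤0 = inj₁ (inj₁ (ΓRPole-*4 r r≤0 (id₁ r)))
  where
  id₁ : ∀ r → r ℤ.* + 2 ℤ.* + 2 ≡ r ℤ.* + 4
  id₁ = solve-∀
...   | inj₂ 1≤r = inj₂ (inj₂ (ΓRPole-*4 (+ 1 - r) (ℤP.i≤j⇒i-j≤0 1≤r) (id₂ r)))
  where
  id₂ : ∀ r → + 2 - r ℤ.* + 2 ℤ.* + 2 + + 2 ≡ (+ 1 - r) ℤ.* + 4
  id₂ = solve-∀
even⇒ΓRPole (divides q refl) | r , inj₂ refl with ≤0⊎1≤ (r + + 1)
...   | inj₁ r+1≤0 = inj₁ (inj₂ (ΓRPole-*4 (r + + 1) r+1≤0 (id₃ r)))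
  where
  id₃ : ∀ r → (r ℤ.* + 2 + + 1) ℤ.* + 2 + + 2 ≡ (r + + 1) ℤ.* + 4
  id₃ = solve-∀
...   | inj₂ 1≤r+1 = inj₂ (inj₁ (ΓRPole-*4 (+ 1 - (r + + 1)) (ℤP.i≤j⇒i-j≤0 1≤r+1) (id₄ r)))
  where
  id₄ : ∀ r → + 2 - (r ℤ.* + 2 + + 1) ℤ.* + 2 ≡ (+ 1 - (r + + 1)) ℤ.* + 4
  id₄ = solve-∀

Pole⇒∈ : ∀ {S ρ} → Pole S ρ → ∃ λ a → a ∈ ρ × PoleIrr S a
Pole⇒∈ (here p)  = _ , here refl , p
Pole⇒∈ (there p) = let a , a∈ρ , pₐ = Pole⇒∈ p in a , there a∈ρ , pₐ

∈⇒Pole : ∀ {S a ρ} → a ∈ ρ → PoleIrr S a → Pole S ρ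
∈⇒Pole (here refl) p = here p
∈⇒Pole (there a∈ρ) p = there (∈⇒Pole a∈ρ p)

∈-⊗⁻ : ∀ {a ρ σ} → a ∈ ρ ⊗ σ → ∃₂ λ x y → x ∈ ρ × y ∈ σ × a ∈ x ⊗ᵢ y
∈-⊗⁻ {ρ = ρ} {σ} a∈ with find (∈-concatMap⁻ (λ x → concatMap (x ⊗ᵢ_) σ) {xs = ρ} a∈)
... | x , x∈ρ , a∈x⊗σ with find (∈-concatMap⁻ (x ⊗ᵢ_) {xs = σ} a∈x⊗σ)
...   | y , y∈σ , a∈x⊗y = x , y , x∈ρ , y∈σ , a∈x⊗y

∈-⊗⁺ : ∀ {a x y ρ σ} → x ∈ ρ → y ∈ σ → a ∈ x ⊗ᵢ y → a ∈ ρ ⊗ σ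
∈-⊗⁺ {x = x} {σ = σ} x∈ρ y∈σ a∈x⊗y =
  ∈-concatMap⁺ (λ x → concatMap (x ⊗ᵢ_) σ)
    (lose x∈ρ (∈-concatMap⁺ (x ⊗ᵢ_) (lose y∈σ a∈x⊗y)))

Two≥ : ℕ → ℤ → WIrr → Set
Two≥ L V a = ∃ λ k → L ℕ.≤ k × a ≡ two k V

¬Pole-Two≥ : ∀ {L V T ρ} → (∀ {a} → a ∈ ρ → Two≥ L V a) → + 0 ℤ.< T + V + + L → ¬ Pole T ρ
¬Pole-Two≥ {V = V} {T = T} bounded 0<T+V+L pole with Pole⇒∈ pole
... | a , a∈ρ , poleₐ with bounded a∈ρ
...   | k , L≤k , refl =
  ℤP.<⇒≱ (ℤP.<-≤-trans 0<T+V+L (ℤP.+-monoʳ-≤ (T + V) (+≤+ L≤k))) (proj₁ poleₐ)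

Two≥-dual : ∀ {L V ρ} → (∀ {a} → a ∈ ρ → Two≥ L V a) → ∀ {a} → a ∈ dual ρ → Two≥ L (- V) a
Two≥-dual bounded a∈ with ∈-map⁻ dualᵢ a∈
... | b , b∈ρ , refl with bounded b∈ρ
...   | k , L≤k , refl = k , L≤k , refl

critical-Two≥ : ∀ {n m L V τ T} → (∀ {a} → a ∈ τ → Two≥ L V a) →
  + 2 ∣ T - + (n ℕ.+ m) → + 0 ℤ.< T + V + + L → + 0 ℤ.< + 2 - T + - V + + L →
  Critical n m τ T
critical-Two≥ bounded parity pos pos-dual =
  ∣⇒∣ᵤ parity , ¬Pole-Two≥ bounded pos , ¬Pole-Two≥ (Two≥-dual bounded) pos-dual

-- The constituent (0,t): the tensor product of (0,·) with a character is
-- left unsplit by _⊗ᵢ_, so it occurs either as two 0 V or as the sign pair.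
Has[0,t] : ℤ → WRep → Set
Has[0,t] V ρ = two 0 V ∈ ρ ⊎ (one false V ∈ ρ × one true V ∈ ρ)

2-T-V≡2-[T+V] : ∀ T V → + 2 - T + - V ≡ + 2 - (T + V)
2-T-V≡2-[T+V] = solve-∀

Has[0,t]⇒Pole : ∀ {T V ρ} → Has[0,t] V ρ → + 2 ∣ T + V → Pole T ρ ⊎ Pole (+ 2 - T) (dual ρ)
Has[0,t]⇒Pole {T} {V} (inj₁ two0∈ρ) even with even⇒ΓCPole⊎ΓCPole-reflected even
... | inj₁ p = inj₁ (∈⇒Pole two0∈ρ (subst ΓCPole (sym (ℤP.+-identityʳ (T + V))) p))
... | inj₂ p = inj₂ (∈⇒Pole (∈-map⁺ dualᵢ two0∈ρ)
                      (subst ΓCPole (sym (trans (ℤP.+-identityʳ _) (2-T-V≡2-[T+V] T V))) p))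
Has[0,t]⇒Pole {T} {V} (inj₂ (sgn⁰∈ρ , sgn¹∈ρ)) even with even⇒ΓRPole even
... | inj₁ (inj₁ p) = inj₁ (∈⇒Pole sgn⁰∈ρ (subst ΓRPole (sym (ℤP.+-identityʳ (T + V))) p))
... | inj₁ (inj₂ p) = inj₁ (∈⇒Pole sgn¹∈ρ p)
... | inj₂ (inj₁ p) = inj₂ (∈⇒Pole (∈-map⁺ dualᵢ sgn⁰∈ρ)
                             (subst ΓRPole (sym (trans (ℤP.+-identityʳ _) (2-T-V≡2-[T+V] T V))) p))
... | inj₂ (inj₂ p) = inj₂ (∈⇒Pole (∈-map⁺ dualᵢ sgn¹∈ρ)
                             (subst ΓRPole (sym (cong (_+ + 2) (2-T-V≡2-[T+V] T V))) p))

1+a*2≡suc[a+a] : ∀ a → 1 ℕ.+ a ℕ.* 2 ≡ suc (a ℕ.+ a)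
1+a*2≡suc[a+a] = ℕSolver.solve-∀

suc[a+a]%2≡1 : ∀ a → suc (a ℕ.+ a) % 2 ≡ 1
suc[a+a]%2≡1 a = subst (λ k → k % 2 ≡ 1) (1+a*2≡suc[a+a] a) ([m+kn]%n≡m%n 1 a 2)

odd⇒≡suc[q+q] : ∀ {N} → N % 2 ≡ 1 → N ≡ suc (N / 2 ℕ.+ N / 2)
odd⇒≡suc[q+q] {N} odd =
  trans (m≡m%n+[m/n]*n N 2) (trans (cong (ℕ._+ (N / 2) ℕ.* 2) odd) (1+a*2≡suc[a+a] (N / 2)))

suc-toℕ+toℕ-opposite : ∀ {N} (i : Fin N) → suc (toℕ i) ℕ.+ toℕ (opposite i) ≡ N
suc-toℕ+toℕ-opposite i =
  trans (cong (suc (toℕ i) ℕ.+_) (FinP.opposite-prop i)) (ℕP.m+[n∸m]≡n (FinP.toℕ<n i))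

2*suc≤ : ∀ {a b N} → a ℕ.< b → suc a ℕ.+ b ≡ N → 2 ℕ.* suc a ℕ.≤ N
2*suc≤ {a} {b} a<b refl = ℕP.+-monoʳ-≤ (suc a) (subst (ℕ._≤ b) (sym (ℕP.+-identityʳ (suc a))) a<b)

-- 2 * suc (toℕ i) ≤ N says that i is one of the first ⌊N/2⌋ indices, those listed by piW.
first-half⊎middle : ∀ {N} (i : Fin N) →
  2 ℕ.* suc (toℕ i) ℕ.≤ N ⊎ 2 ℕ.* suc (toℕ (opposite i)) ℕ.≤ N ⊎ (opposite i ≡ i × N % 2 ≡ 1)
first-half⊎middle {N} i with ℕP.<-cmp (toℕ i) (toℕ (opposite i))
... | tri< i<i' _ _ = inj₁ (2*suc≤ i<i' (suc-toℕ+toℕ-opposite i))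
... | tri> _ _ i'<i = inj₂ (inj₁ (2*suc≤ i'<i mirrored))
  where
  mirrored : suc (toℕ (opposite i)) ℕ.+ toℕ i ≡ N
  mirrored = trans (cong suc (ℕP.+-comm _ (toℕ i))) (suc-toℕ+toℕ-opposite i)
... | tri≈ _ i≡i' _ = inj₂ (inj₂ (FinP.toℕ-injective (sym i≡i') , odd))
  where
  odd : N % 2 ≡ 1
  odd = subst (λ k → k % 2 ≡ 1)
          (trans (cong (λ k → suc (toℕ i ℕ.+ k)) i≡i') (suc-toℕ+toℕ-opposite i))
          (suc[a+a]%2≡1 (toℕ i))

odd⇒∃opposite-fixed : ∀ {N} → N % 2 ≡ 1 → ∃ λ (i : Fin N) → opposite i ≡ i
odd⇒∃opposite-fixed {N} odd = i , FinP.toℕ-injective fixed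
  where
  q = N / 2
  N≡ : N ≡ suc (q ℕ.+ q)
  N≡ = odd⇒≡suc[q+q] odd
  q<N : q ℕ.< N
  q<N = subst (q ℕ.<_) (sym N≡) (s≤s (ℕP.m≤m+n q q))
  i = fromℕ< q<N
  fixed : toℕ (opposite i) ≡ toℕ i
  fixed = trans (FinP.opposite-prop i)
          (trans (cong (λ k → N ℕ.∸ suc k) (FinP.toℕ-fromℕ< q<N))
          (trans (cong (ℕ._∸ suc q) N≡)
          (trans (ℕP.m+n∸m≡n q q) (sym (FinP.toℕ-fromℕ< q<N)))))

module Labels {N w} {l : Fin N → ℤ} (P : L0plus N w l) where

  l-opposite : ∀ i → l (opposite i) ≡ - l i
  l-opposite i = inverseʳ-unique (l i) (l (opposite i)) (L0plus.antisym P i)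

  fixed⇒l≡0 : ∀ {i} → opposite i ≡ i → l i ≡ + 0
  fixed⇒l≡0 {i} fixed = i+i≡0⇒i≡0 (subst (λ k → l i + l k ≡ + 0) fixed (L0plus.antisym P i))

  label-∣∣ : ∀ i → ∃ λ k → l k ≡ + ∣ l i ∣
  label-∣∣ i with l i in eq
  ... | + a      = i , eq
  ... | -[1+ a ] = opposite i , trans (l-opposite i) (cong -_ eq)

  label-neg∣∣ : ∀ i → ∃ λ k → l k ≡ - + ∣ l i ∣
  label-neg∣∣ i with l i in eq
  ... | + a      = opposite i , trans (l-opposite i) (cong -_ eq)
  ... | -[1+ a ] = i , eq

  label-0 : N % 2 ≡ 1 → ∃ λ k → l k ≡ + 0
  label-0 odd = let i , fixed = odd⇒∃opposite-fixed odd in i , fixed⇒l≡0 fixed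

  first-half-label⊎middle : ∀ i →
    (∃ λ k → 2 ℕ.* suc (toℕ k) ℕ.≤ N × ∣ l k ∣ ≡ ∣ l i ∣) ⊎ (N % 2 ≡ 1 × l i ≡ + 0)
  first-half-label⊎middle i with first-half⊎middle i
  ... | inj₁ half                = inj₁ (i , half , refl)
  ... | inj₂ (inj₁ half)          = inj₁ (opposite i , half , ∣l-opposite∣)
    where
    ∣l-opposite∣ : ∣ l (opposite i) ∣ ≡ ∣ l i ∣
    ∣l-opposite∣ = trans (cong ∣_∣ (l-opposite i)) (ℤP.∣-i∣≡∣i∣ (l i))
  ... | inj₂ (inj₂ (fixed , odd)) = inj₂ (odd , fixed⇒l≡0 fixed)

∈-if-does : ∀ {p} {P : Set p} {a x : WIrr} (P? : Dec P) →
  a ∈ (if does P? then x ∷ [] else []) → P × a ≡ x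
∈-if-does (yes p) (here a≡x) = p , a≡x

module PiW {N} (w : ℤ) (l : Fin N → ℤ) (δ : Bool) where

  private
    firstHalf? : (i : Fin N) → Dec (2 ℕ.* suc (toℕ i) ℕ.≤ N)
    firstHalf? i = 2 ℕ.* suc (toℕ i) ℕ.≤? N

    label : Fin N → WIrr
    label i = two ∣ l i ∣ (- w)

  ∈⁻ : ∀ {a} → a ∈ piW N w l δ → (∃ λ i → a ≡ two ∣ l i ∣ (- w)) ⊎ (N % 2 ≡ 1 × a ≡ one δ (- w))
  ∈⁻ a∈ with ∈-++⁻ (map label (filter firstHalf? (allFin N))) a∈
  ... | inj₁ a∈labels = let i , _ , a≡ = ∈-map⁻ label a∈labels in inj₁ (i , a≡)
  ... | inj₂ a∈odd    = inj₂ (∈-if-does (N % 2 ℕ.≟ 1) a∈odd)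

  ∈-two : ∀ {i} → 2 ℕ.* suc (toℕ i) ℕ.≤ N → two ∣ l i ∣ (- w) ∈ piW N w l δ
  ∈-two half = ∈-++⁺ˡ (∈-map⁺ label (∈-filter⁺ firstHalf? (∈-allFin _) half))

  ∈-one : N % 2 ≡ 1 → one δ (- w) ∈ piW N w l δ
  ∈-one odd = ∈-++⁺ʳ _ (subst (λ b → one δ (- w) ∈ (if b then one δ (- w) ∷ [] else []))
                             (sym (dec-true (N % 2 ℕ.≟ 1) odd)) (here refl))

module Distance {n m} (l : Fin n → ℤ) (l' : Fin m → ℤ) where

  distancesFrom : Fin n → List ℕ
  distancesFrom i = map (λ j → ∣ l i - l' j ∣) (allFin m)

  ∈-distances : ∀ i j → ∣ l i - l' j ∣ ∈ concatMap distancesFrom (allFin n)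
  ∈-distances i j =
    ∈-concatMap⁺ distancesFrom (lose (∈-allFin i) (∈-map⁺ (λ j → ∣ l i - l' j ∣) (∈-allFin j)))

  L0-≤ : ∀ {x y} → (∃ λ i → l i ≡ x) → (∃ λ j → l' j ≡ y) → L0 n m l l' ℕ.≤ ∣ x - y ∣
  L0-≤ (i , refl) (j , refl) = minList-≤ (∈-distances i j)

  L0-attained : Fin n → Fin m → ∃₂ λ i j → L0 n m l l' ≡ ∣ l i - l' j ∣
  L0-attained i₀ j₀
    with find (∈-concatMap⁻ distancesFrom {xs = allFin n} (minList-∈ (∈-distances i₀ j₀)))
  ... | i , _ , L0∈ with ∈-map⁻ (λ j → ∣ l i - l' j ∣) L0∈
  ...   | j , _ , L0≡ = i , j , L0≡

  disjoint⇒L0≢0 : Fin n → Fin m → (∀ i j → l i ≢ l' j) → L0 n m l l' ≢ 0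
  disjoint⇒L0≢0 i₀ j₀ disjoint L0≡0 =
    let i , j , L0≡ = L0-attained i₀ j₀
    in disjoint i j (ℤP.i-j≡0⇒i≡j _ _ (ℤP.∣i∣≡0⇒i≡0 (trans (sym L0≡) L0≡0)))

  L0≢0⇒disjoint : L0 n m l l' ≢ 0 → ∀ i j → l i ≢ l' j
  L0≢0⇒disjoint L0≢0 i j li≡l'j =
    L0≢0 (ℕP.n≤0⇒n≡0 (subst (L0 n m l l' ℕ.≤_) ∣l'j-l'j∣≡0 (L0-≤ (i , li≡l'j) (j , refl))))
    where
    ∣l'j-l'j∣≡0 : ∣ l' j - l' j ∣ ≡ 0
    ∣l'j-l'j∣≡0 = cong ∣_∣ (ℤP.+-inverseʳ (l' j))

module Tensor {n m w w'} {l : Fin n → ℤ} {l' : Fin m → ℤ}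
              (P : L0plus n w l) (P' : L0plus m w' l') (δ δ' : Bool)
              (not-both-odd : ¬ (n % 2 ≡ 1 × m % 2 ≡ 1)) where

  open Distance l l'
  private
    module Λ  = Labels P
    module Λ' = Labels P'
    module π  = PiW w l δ
    module π' = PiW w' l' δ'

  τ : WRep
  τ = piW n w l δ ⊗ piW m w' l' δ'

  V : ℤ
  V = - w + - w'

  L : ℕ
  L = L0 n m l l'

  T₀ : ℤ
  T₀ = + L + (w + w')

  module _ (disjoint : ∀ i j → l i ≢ l' j) where

    disjoint⇒∣∣≢∣∣ : ∀ i j → ∣ l i ∣ ≢ ∣ l' j ∣
    disjoint⇒∣∣≢∣∣ i j ∣li∣≡∣l'j∣ =
      let k , lk≡ = Λ.label-∣∣ i ; k' , l'k'≡ = Λ'.label-∣∣ j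
      in disjoint k k' (trans lk≡ (trans (cong +_ ∣li∣≡∣l'j∣) (sym l'k'≡)))

    two⊗two-Two≥ : ∀ i j {a} → a ∈ (two ∣ l i ∣ (- w)) ⊗ᵢ (two ∣ l' j ∣ (- w')) → Two≥ L V a
    two⊗two-Two≥ i j (here refl) =
      _ , subst (L ℕ.≤_) (∣+a--+b∣ ∣ l i ∣ ∣ l' j ∣) (L0-≤ (Λ.label-∣∣ i) (Λ'.label-neg∣∣ j)) , refl
    two⊗two-Two≥ i j (there a∈) with distℕ ∣ l i ∣ ∣ l' j ∣ in dist≡
    ... | zero  = contradiction (ℕP.∣m-n∣≡0⇒m≡n dist≡) (disjoint⇒∣∣≢∣∣ i j)
    ... | suc k with a∈
    ...   | here refl = suc k , L≤ , refl
      where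
      L≤ : L ℕ.≤ suc k
      L≤ = subst (L ℕ.≤_) (trans (∣+a-+b∣ ∣ l i ∣ ∣ l' j ∣) dist≡)
                 (L0-≤ (Λ.label-∣∣ i) (Λ'.label-∣∣ j))

    τ-Two≥ : ∀ {a} → a ∈ τ → Two≥ L V a
    τ-Two≥ a∈ with ∈-⊗⁻ a∈
    ... | x , y , x∈ , y∈ , a∈x⊗y with π.∈⁻ x∈ | π'.∈⁻ y∈ | a∈x⊗y
    ... | inj₁ (i , refl) | inj₁ (j , refl) | _ = two⊗two-Two≥ i j a∈x⊗y
    ... | inj₁ (i , refl) | inj₂ (m-odd , refl) | here refl =
      ∣ l i ∣ , subst (L ℕ.≤_) (trans (∣+a-+b∣ _ 0) (ℕP.∣-∣-identityʳ _))
                                (L0-≤ (Λ.label-∣∣ i) (Λ'.label-0 m-odd)) , refl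
    ... | inj₂ (n-odd , refl) | inj₁ (j , refl) | here refl =
      ∣ l' j ∣ , subst (L ℕ.≤_) (∣+a--+b∣ 0 _) (L0-≤ (Λ.label-0 n-odd) (Λ'.label-neg∣∣ j)) , refl
    ... | inj₂ (n-odd , _) | inj₂ (m-odd , _) | _ = contradiction (n-odd , m-odd) not-both-odd

    module _ (i₀ : Fin n) (j₀ : Fin m) where

      0<2L : + 0 ℤ.< + L + + L
      0<2L = +<+ (ℕP.<-≤-trans (ℕP.n≢0⇒n>0 (disjoint⇒L0≢0 i₀ j₀ disjoint)) (ℕP.m≤m+n L L))

      T₀-parity : + 2 ∣ T₀ - + (n ℕ.+ m)
      T₀-parity =
        let i , j , L≡ = L0-attained i₀ j₀
        in subst (λ k → + 2 ∣ + k + (w + w') - + (n ℕ.+ m)) (sym L≡)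
             (labels⇒even {w} {w'} {l i} {l' j} {+ n} {+ m}
                (∣ᵤ⇒∣ (L0plus.parity P i)) (∣ᵤ⇒∣ (L0plus.parity P' j)))

      critical-T₀ : Critical n m τ T₀
      critical-T₀ =
        critical-Two≥ {n} {m} τ-Two≥ T₀-parity
          (subst (+ 0 ℤ.<_) (sym (at-T₀ (+ L) w w')) 0<2L)
          (subst (+ 0 ℤ.<_) (sym (at-T₀-dual (+ L) w w')) (+<+ (s≤s z≤n)))
        where
        at-T₀ : ∀ L w w' → L + (w + w') + (- w + - w') + L ≡ L + L
        at-T₀ = solve-∀
        at-T₀-dual : ∀ L w w' → + 2 - (L + (w + w')) + - (- w + - w') + L ≡ + 2
        at-T₀-dual = solve-∀

      critical-θT₀ : Critical n m τ (+ 2 ℤ.* (w + w' + + 1) - T₀)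
      critical-θT₀ =
        critical-Two≥ {n} {m} τ-Two≥ (even⇒even-reflected {T₀} {w + w'} T₀-parity)
          (subst (+ 0 ℤ.<_) (sym (at-θT₀ (+ L) w w')) (+<+ (s≤s z≤n)))
          (subst (+ 0 ℤ.<_) (sym (at-θT₀-dual (+ L) w w')) 0<2L)
        where
        at-θT₀ : ∀ L w w' → + 2 ℤ.* (w + w' + + 1) - (L + (w + w')) + (- w + - w') + L ≡ + 2
        at-θT₀ = solve-∀
        at-θT₀-dual : ∀ L w w' →
          + 2 - (+ 2 ℤ.* (w + w' + + 1) - (L + (w + w'))) + - (- w + - w') + L ≡ L + L
        at-θT₀-dual = solve-∀

  shared-label⇒Has[0,t] : ∀ {i j} → l i ≡ l' j → Has[0,t] V τ
  shared-label⇒Has[0,t] {i} {j} li≡l'j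
    with Λ.first-half-label⊎middle i | Λ'.first-half-label⊎middle j
  ... | inj₁ (k , half , ∣lk∣≡) | inj₁ (k' , half' , ∣l'k'∣≡) =
    inj₂ (in-τ (split∈ (here refl)) , in-τ (split∈ (there (here refl))))
    where
    in-τ : ∀ {c} → c ∈ (two ∣ l k ∣ (- w)) ⊗ᵢ (two ∣ l' k' ∣ (- w')) → c ∈ τ
    in-τ = ∈-⊗⁺ (π.∈-two half) (π'.∈-two half')
    split∈ : ∀ {c} → c ∈ one false V ∷ one true V ∷ [] →
             c ∈ (two ∣ l k ∣ (- w)) ⊗ᵢ (two ∣ l' k' ∣ (- w'))
    split∈ c∈ rewrite ℕP.m≡n⇒∣m-n∣≡0 (trans ∣lk∣≡ (trans (cong ∣_∣ li≡l'j) (sym ∣l'k'∣≡))) =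
      there c∈
  ... | inj₁ (k , half , ∣lk∣≡) | inj₂ (m-odd , l'j≡0) =
    inj₁ (∈-⊗⁺ (π.∈-two half) (π'.∈-one m-odd) (here (cong (λ c → two c V) (sym ∣lk∣≡0))))
    where
    ∣lk∣≡0 : ∣ l k ∣ ≡ 0
    ∣lk∣≡0 = trans ∣lk∣≡ (cong ∣_∣ (trans li≡l'j l'j≡0))
  ... | inj₂ (n-odd , li≡0) | inj₁ (k' , half' , ∣l'k'∣≡) =
    inj₁ (∈-⊗⁺ (π.∈-one n-odd) (π'.∈-two half') (here (cong (λ c → two c V) (sym ∣l'k'∣≡0))))
    where
    ∣l'k'∣≡0 : ∣ l' k' ∣ ≡ 0
    ∣l'k'∣≡0 = trans ∣l'k'∣≡ (cong ∣_∣ (trans (sym li≡l'j) li≡0))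
  ... | inj₂ (n-odd , _) | inj₂ (m-odd , _) = contradiction (n-odd , m-odd) not-both-odd

  critical⇒disjoint : ∀ {T} → Critical n m τ T → ∀ i j → l i ≢ l' j
  critical⇒disjoint {T} (parity , ¬pole , ¬dual-pole) i j li≡l'j =
    [ ¬pole , ¬dual-pole ]′ (Has[0,t]⇒Pole (shared-label⇒Has[0,t] li≡l'j) even)
    where
    even : + 2 ∣ T + V
    even = shared-label⇒even {T} {w} {w'} {l' j} {+ n} {+ m} (∣ᵤ⇒∣ parity)
             (subst (λ x → + 2 ∣ w + x - + suc n) li≡l'j (∣ᵤ⇒∣ (L0plus.parity P i)))
             (∣ᵤ⇒∣ (L0plus.parity P' j))

proposition2p3 : (n m : ℕ) → 1 ℕ.≤ n → 1 ℕ.≤ m →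
    (w : ℤ) (l : Fin n → ℤ) → L0plus n w l →
    (w' : ℤ) (l' : Fin m → ℤ) → L0plus m w' l' →
    (δ δ' : Bool) →
    ¬ ((n % 2 ≡ 1) × (m % 2 ≡ 1)) →
    let τ = piW n w l δ ⊗ piW m w' l' δ'
        T₀ = + L0 n m l l' + (w + w')
    in ((∃ λ T → Critical n m τ T) ⇔ (∀ i j → l i ≢ l' j))
       × ((∀ i j → l i ≢ l' j) ⇔ (L0 n m l l' ≢ 0))
       × ((∀ i j → l i ≢ l' j) →
            Critical n m τ T₀
            × Critical n m τ ((+ 2) ℤ.* (w + w' + + 1) - T₀))
proposition2p3 n m 0<n 0<m w l P w' l' P' δ δ' not-both-odd =
    mk⇔ (λ (_ , critical) → critical⇒disjoint critical)
        (λ disjoint → T₀ , critical-T₀ disjoint i₀ j₀)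
  , mk⇔ (disjoint⇒L0≢0 i₀ j₀) L0≢0⇒disjoint
  , λ disjoint → critical-T₀ disjoint i₀ j₀ , critical-θT₀ disjoint i₀ j₀
  where
  open Tensor P P' δ δ' not-both-odd
  open Distance l l'
  i₀ = fromℕ< 0<n
  j₀ = fromℕ< 0<m
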